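{- Let $n\geq 5$. For every $j\in\mathbb{Z}$ and every directed spanning tree $\overrightarrow{G}$ of $\overrightarrow{C_n^2}$ rooted by $v_j$, there exists a unique nontrivial weakly connected spanning closed subgraph $\overrightarrow{H}$ of $\overrightarrow{C_n^2}$ such that $E(\overrightarrow{G})\subseteq E(\overrightarrow{H})$, and such $\overrightarrow{H}$ is of the form $\overrightarrow{S_{n,k,j'}}$ with $0\leq k\leq\lceil\frac{n-2}{2}\rceil$, $0\leq j'\leq n-1$. More precisely, for every $j\in\mathbb{Z}$, \[ T_{\overrightarrow{C_n^2},v_j}=\bigcup_{k=0}^{\lceil\frac{n-2}{2}\rceil}T_{\overrightarrow{S_{n,k,j}},v_j}, \] and this union is disjoint.
   Context: For $n\geq 5$, the directed square cycle $\overrightarrow{C_n^2}$ has vertex set $\mathbb{Z}_n$, writing $v_i=i+n\mathbb{Z}$ for $i\in\mathbb{Z}$ (indices modulo $n$), and edges $e_i=(v_i,v_{i+1})$ (frames) and $f_i=(v_i,v_{i+2})$ (windows), $i\in\mathbb{Z}$. A spanning subgraph has vertex set $\mathbb{Z}_n$ and a subset of the edges; it is weakly connected if its underlying undirected graph is connected. The triangle $T_i$ is $\{e_i,e_{i+1},f_i\}$; a subgraph $\overrightarrow{G}$ is closed if for every $i$, $|T_i\cap E(\overrightarrow{G})|\leq 1$ or $T_i\subseteq E(\overrightarrow{G})$. The trivial weakly connected spanning closed subgraphs are $\overrightarrow{C_n^2}$ itself and, when $n$ is odd, the subgraph whose edges are all the windows $f_0,\dots,f_{n-1}$; all others are nontrivial.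 For integers $j,k$ with $0\leq k\leq\lceil\frac{n-2}{2}\rceil$, $\overrightarrow{S_{n,k,j}}$ is the spanning subgraph of $\overrightarrow{C_n^2}$ with edge set $E(\overrightarrow{C_n^2})\setminus\big(\{f_{j-2},f_{j+2k-1}\}\cup\{e_{j-1},e_j,\dots,e_{j+2k-1}\}\big)$. For a directed graph $\overrightarrow{G}$ and vertex $u$, a directed spanning tree rooted by $u$ is a spanning subgraph whose underlying undirected graph is connected, which has no closed paths, in which every vertex $v\neq u$ has in-degree $1$, and in which every vertex $v\neq u$ is reachable from $u$ by a directed path; $T_{\overrightarrow{G},u}$ denotes the set of all such trees (viewed as edge sets). -}

module Defs where

open import Data.Nat as ℕ using (ℕ; zero; suc; NonZero; _≤_; _<_; ⌈_/2⌉; _∸_; _%_)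
open import Data.Integer as ℤ using (ℤ; +_)
open import Data.Integer.DivMod using (_%ℕ_; n%ℕd<d)
open import Data.Fin using (Fin; toℕ; fromℕ<; _≟_)
open import Data.Bool using (Bool; true; false; not; _∨_; T)
open import Data.List using (List; []; _∷_; upTo)
open import Data.Bool.ListAction using (any)
open import Data.Product using (Σ; _×_; _,_; ∃)
open import Data.Sum using (_⊎_)
open import Relation.Nullary using (¬_; ⌊_⌋)
open import Relation.Binary.PropositionalEquality using (_≡_; _≢_)

vtx : (n : ℕ) .{{_ : NonZero n}} → ℤ → Fin n
vtx n i = fromℕ< (n%ℕd<d i n)

-- Edges of C_n^2: frames e_i = (v_i, v_{i+1}) and windows f_i = (v_i, v_{i+2}), i ∈ Fin n.
data Kind : Set where
  frame window : Kind

Edge : ℕ → Set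
Edge n = Kind × Fin n

e : (n : ℕ) .{{_ : NonZero n}} → ℤ → Edge n
e n i = frame , vtx n i

f : (n : ℕ) .{{_ : NonZero n}} → ℤ → Edge n
f n i = window , vtx n i

tail : {n : ℕ} .{{_ : NonZero n}} → Edge n → Fin n
tail (_ , i) = i

head : {n : ℕ} .{{_ : NonZero n}} → Edge n → Fin n
head {n} (frame  , i) = vtx n (+ toℕ i ℤ.+ + 1)
head {n} (window , i) = vtx n (+ toℕ i ℤ.+ + 2)

-- A spanning subgraph of C_n^2 is given by its (decidable) edge set.
Sub : ℕ → Set
Sub n = Edge n → Bool

full : (n : ℕ) → Sub n
full n _ = true

_⊆E_ : {n : ℕ} → Sub n → Sub n → Set
G ⊆E H = ∀ x → G x ≡ true → H x ≡ true

_≐_ : {n : ℕ} → Sub n → Sub n → Set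
G ≐ H = ∀ x → G x ≡ H x

module _ {n : ℕ} .{{_ : NonZero n}} where

  data Reach (G : Sub n) : Fin n → Fin n → Set where
    here : ∀ {u} → Reach G u u
    step : ∀ {u v} (x : Edge n) → G x ≡ true → tail x ≡ u → Reach G (head x) v → Reach G u v

  data UReach (G : Sub n) : Fin n → Fin n → Set where
    here : ∀ {u} → UReach G u u
    fwd  : ∀ {u v} (x : Edge n) → G x ≡ true → tail x ≡ u → UReach G (head x) v → UReach G u v
    bwd  : ∀ {u v} (x : Edge n) → G x ≡ true → head x ≡ u → UReach G (tail x) v → UReach G u v

  WeaklyConnected : Sub n → Set
  WeaklyConnected G = ∀ u v → UReach G u v

  HasClosedPath : Sub n → Set
  HasClosedPath G = Σ (Edge n) λ x → G x ≡ true × Reach G (head x) (tail x)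

  InDegOne : Sub n → Fin n → Set
  InDegOne G v = Σ (Edge n) λ x → (G x ≡ true × head x ≡ v) ×
                   (∀ y → G y ≡ true → head y ≡ v → y ≡ x)

  IsDirSpanningTree : Sub n → Fin n → Sub n → Set
  IsDirSpanningTree G u Tr =
    Tr ⊆E G × WeaklyConnected Tr × ¬ HasClosedPath Tr ×
    (∀ v → v ≢ u → InDegOne Tr v) × (∀ v → v ≢ u → Reach Tr u v)

  b2n : Bool → ℕ
  b2n true  = 1
  b2n false = 0

  Closed : Sub n → Set
  Closed G = ∀ (i : ℤ) →
    (b2n (G (e n i)) ℕ.+ b2n (G (e n (i ℤ.+ + 1))) ℕ.+ b2n (G (f n i)) ≤ 1)
    ⊎ (G (e n i) ≡ true × G (e n (i ℤ.+ + 1)) ≡ true × G (f n i) ≡ true)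

  windows : Sub n
  windows (frame  , _) = false
  windows (window , _) = true

  Trivial : Sub n → Set
  Trivial G = G ≐ full n ⊎ (n % 2 ≡ 1 × G ≐ windows)

  Nontrivial : Sub n → Set
  Nontrivial G = ¬ Trivial G

  -- S_{n,k,j}: remove f_{j-2}, f_{j+2k-1} and e_{j-1}, e_j, ..., e_{j+2k-1}
  S : ℕ → ℤ → Sub n
  S k j (frame , i) =
    not (any (λ t → ⌊ i ≟ vtx n (j ℤ.- + 1 ℤ.+ + t) ⌋) (upTo (suc (2 ℕ.* k))))
  S k j (window , i) =
    not (⌊ i ≟ vtx n (j ℤ.- + 2) ⌋ ∨ ⌊ i ≟ vtx n (j ℤ.+ + (2 ℕ.* k) ℤ.- + 1) ⌋)

  GoodCover : Sub n → Sub n → Set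
  GoodCover Tr H = Nontrivial H × WeaklyConnected H × Closed H × Tr ⊆E H

-- Measure every vertex by its position h = i - j (mod n) relative to the root v_j; the frame
-- fr h = e_{j+h-1} and the window wi h = f_{j+h-2} are the two edges entering position h.
-- In a directed spanning tree rooted at v_j no edge enters the root and every other position is
-- entered by exactly one of its two edges.  The first position p ≥ 1 entered by a tree frame is
-- odd, p = 2k+1: were it even, tree edges leaving even positions below p would stay there, and
-- position 1 would be unreachable.  So the tree contains the windows into 1, …, 2k, the frame
-- into 2k+1 (if 2k+1 < n) and an edge into every later position.  In a closed subgraph H
-- containing these edges, the triangles force the frames into 0, …, 2k to agree and the frames
-- into 2k+1, …, n-1 to be present; if the former were present H would be everything, so they are
-- absent, and the triangles then determine every window: H is S_{n,k,j}.  Conversely S_{n,k,j}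
-- is closed, nontrivial and contains the tree, and the edge entering 2k+1 distinguishes k from
-- every other level.
module Submission where

open import Defs
open import Data.Nat using (ℕ; NonZero; _≤_; _<_; ⌈_/2⌉; _∸_)
open import Data.Integer using (ℤ; +_)
open import Data.Product using (Σ; _×_; _,_)
open import Relation.Binary.PropositionalEquality using (_≡_)

open import Data.Bool using (Bool; true; false; not; _∨_)
open import Data.Bool.ListAction using (any)
open import Data.Bool.Properties using (T-≡; ¬-not; ∨-zeroʳ)
open import Data.Empty using (⊥; ⊥-elim)
open import Data.Fin as Fin using (Fin; toℕ)
open import Data.Fin.Properties using (toℕ-fromℕ<; toℕ-injective; toℕ<n)
open import Data.Integer as ℤ using (+[1+_]; -[1+_]; _%ℕ_; _/ℕ_)
open import Data.Integer.DivMod using (a≡a%ℕn+[a/ℕn]*n; n%ℕd<d)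
import Data.Integer.Properties as ℤP
open import Data.Integer.Tactic.RingSolver using (solve-∀)
open import Data.List using (upTo)
open import Data.List.Membership.Propositional using (lose; find)
open import Data.List.Membership.Propositional.Properties using (∈-upTo⁺; ∈-upTo⁻)
open import Data.List.Relation.Unary.Any.Properties using (any⁺; any⁻)
open import Data.Nat as ℕ using (zero; suc; pred; _%_; ⌊_/2⌋; z≤n; s≤s; s≤s⁻¹; z<s)
open import Data.Nat.DivMod using (m<n⇒m%n≡m; n%n≡0; [m+kn]%n≡m%n)
open import Data.Nat.Properties hiding (_≟_)
open import Data.Sum as Sum using (_⊎_; inj₁; inj₂)
open import Function using (_∘_)
open import Function.Bundles using (Equivalence)
open import Relation.Binary.Definitions using (tri<; tri≈; tri>)
open import Relation.Binary.PropositionalEquality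
  using (_≢_; refl; sym; trans; cong; cong₂; subst; module ≡-Reasoning)
open import Relation.Nullary using (¬_; Dec; yes; no; contradiction)
open import Relation.Nullary.Decidable using (⌊_⌋; isYes≗does; dec-true; dec-false; fromWitness; toWitness)

least-below : (P : ℕ → Bool) (m : ℕ) →
  Σ ℕ λ p → p ≤ m × (∀ h → h < p → P h ≡ false) × (p < m → P p ≡ true)
least-below P zero = 0 , z≤n , (λ _ ()) , λ ()
least-below P (suc m) with least-below P m
... | p , p≤m , below , first with m≤n⇒m<n∨m≡n p≤m
...   | inj₁ p<m = p , m≤n⇒m≤1+n p≤m , below , λ _ → first p<m
...   | inj₂ refl with P p in Pp
...     | true  = p , n≤1+n p , below , λ _ → Pp
...     | false = suc p , ≤-refl , below′ , λ p<p → contradiction p<p (<-irrefl refl)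
  where
  below′ : ∀ h → h < suc p → P h ≡ false
  below′ h h<1+p with m<1+n⇒m<n∨m≡n h<1+p
  ... | inj₁ h<p  = below h h<p
  ... | inj₂ refl = Pp

even⊎odd : ∀ m → (Σ ℕ λ q → m ≡ 2 ℕ.* q) ⊎ (Σ ℕ λ q → m ≡ suc (2 ℕ.* q))
even⊎odd zero = inj₁ (0 , refl)
even⊎odd (suc m) with even⊎odd m
... | inj₁ (q , refl) = inj₂ (q , refl)
... | inj₂ (q , refl) = inj₁ (suc q , sym (*-suc 2 q))

k<k′⇒2+2k≤2k′ : ∀ {k k′} → k < k′ → 2 ℕ.+ 2 ℕ.* k ≤ 2 ℕ.* k′
k<k′⇒2+2k≤2k′ {k} {k′} k<k′ = subst (_≤ 2 ℕ.* k′) (*-suc 2 k) (*-monoʳ-≤ 2 k<k′)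

2*k≤m⇒k≤⌊m/2⌋ : ∀ {k m} → 2 ℕ.* k ≤ m → k ≤ ⌊ m /2⌋
2*k≤m⇒k≤⌊m/2⌋ {k} 2k≤m = subst (_≤ _) ⌊2k/2⌋≡k (⌊n/2⌋-mono 2k≤m)
  where
  ⌊2k/2⌋≡k : ⌊ 2 ℕ.* k /2⌋ ≡ k
  ⌊2k/2⌋≡k = sym (trans (n≡⌊n+n/2⌋ k) (cong (⌊_/2⌋ ∘ (k ℕ.+_)) (sym (+-identityʳ k))))

k≤⌊m/2⌋⇒2*k≤m : ∀ {k m} → k ≤ ⌊ m /2⌋ → 2 ℕ.* k ≤ m
k≤⌊m/2⌋⇒2*k≤m {k} {m} k≤⌊m/2⌋ = begin
  2 ℕ.* k                    ≤⟨ *-monoʳ-≤ 2 k≤⌊m/2⌋ ⟩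
  ⌊ m /2⌋ ℕ.+ (⌊ m /2⌋ ℕ.+ 0) ≡⟨ cong (⌊ m /2⌋ ℕ.+_) (+-identityʳ _) ⟩
  ⌊ m /2⌋ ℕ.+ ⌊ m /2⌋         ≤⟨ +-monoʳ-≤ ⌊ m /2⌋ (⌊n/2⌋≤⌈n/2⌉ m) ⟩
  ⌊ m /2⌋ ℕ.+ ⌈ m /2⌉         ≡⟨ ⌊n/2⌋+⌈n/2⌉≡n m ⟩
  m                          ∎
  where open ≤-Reasoning

2*k<n⇒k≤⌈n∸2/2⌉ : ∀ {k n} → 1 < n → 2 ℕ.* k < n → k ≤ ⌈ n ∸ 2 /2⌉
2*k<n⇒k≤⌈n∸2/2⌉ (s≤s (s≤s _)) (s≤s 2k≤1+m) = 2*k≤m⇒k≤⌊m/2⌋ 2k≤1+m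

k≤⌈n∸2/2⌉⇒2*k<n : ∀ {k n} → 1 < n → k ≤ ⌈ n ∸ 2 /2⌉ → 2 ℕ.* k < n
k≤⌈n∸2/2⌉⇒2*k<n (s≤s (s≤s _)) k≤ = s≤s (k≤⌊m/2⌋⇒2*k≤m k≤)

module Residues (n : ℕ) .{{_ : NonZero n}} where

  private
    n≤r+[1+m]n : ∀ {r r′} m → + r ℤ.+ +[1+ m ] ℤ.* + n ≡ + r′ → n ≤ r′
    n≤r+[1+m]n {r} m eq = ≤-trans (≤-trans (m≤m+n n _) (m≤n+m _ r)) (≤-reflexive (ℤP.+-injective
      (trans (trans (ℤP.pos-+ r _) (cong (ℤ._+_ (+ r)) (ℤP.pos-* (suc m) n))) eq)))

    move-multiple : ∀ a d b c → a ℤ.+ d ℤ.* b ≡ c → c ℤ.+ (ℤ.- d) ℤ.* b ≡ a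
    move-multiple a d b c refl = cancel a d b
      where
      cancel : ∀ a d b → a ℤ.+ d ℤ.* b ℤ.+ (ℤ.- d) ℤ.* b ≡ a
      cancel = solve-∀

  remainder-unique : ∀ {r r′} d → r < n → r′ < n → + r ℤ.+ d ℤ.* + n ≡ + r′ → r ≡ r′
  remainder-unique {r}      (+ 0)    _   _    eq = trans (sym (+-identityʳ r)) (ℤP.+-injective eq)
  remainder-unique          +[1+ m ] _   r′<n eq = contradiction (n≤r+[1+m]n m eq) (<⇒≱ r′<n)
  remainder-unique {r} {r′} -[1+ m ] r<n _    eq =
    contradiction (n≤r+[1+m]n m (move-multiple (+ r) -[1+ m ] (+ n) (+ r′) eq)) (<⇒≱ r<n)

  %ℕ-unique : ∀ a {r} q → r < n → a ≡ + r ℤ.+ q ℤ.* + n → a %ℕ n ≡ r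
  %ℕ-unique a {r} q r<n refl = remainder-unique (a /ℕ n ℤ.- q) (n%ℕd<d a n) r<n (begin
    + (a %ℕ n) ℤ.+ (a /ℕ n ℤ.- q) ℤ.* + n       ≡⟨ regroup (+ (a %ℕ n)) (a /ℕ n) q (+ n) ⟩
    + (a %ℕ n) ℤ.+ a /ℕ n ℤ.* + n ℤ.- q ℤ.* + n ≡⟨ cong (ℤ._- q ℤ.* + n) (a≡a%ℕn+[a/ℕn]*n a n) ⟨
    + r ℤ.+ q ℤ.* + n ℤ.- q ℤ.* + n              ≡⟨ cancel (+ r) (q ℤ.* + n) ⟩
    + r                                          ∎)
    where
    open ≡-Reasoning
    regroup : ∀ x p q m → x ℤ.+ (p ℤ.- q) ℤ.* m ≡ x ℤ.+ p ℤ.* m ℤ.- q ℤ.* m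
    regroup = solve-∀
    cancel : ∀ x y → x ℤ.+ y ℤ.- y ≡ x
    cancel = solve-∀

  [a+qn]%ℕn≡a%ℕn : ∀ a q → (a ℤ.+ q ℤ.* + n) %ℕ n ≡ a %ℕ n
  [a+qn]%ℕn≡a%ℕn a q = %ℕ-unique (a ℤ.+ q ℤ.* + n) (a /ℕ n ℤ.+ q) (n%ℕd<d a n) (begin
    a ℤ.+ q ℤ.* + n                             ≡⟨ cong (ℤ._+ q ℤ.* + n) (a≡a%ℕn+[a/ℕn]*n a n) ⟩
    + (a %ℕ n) ℤ.+ a /ℕ n ℤ.* + n ℤ.+ q ℤ.* + n ≡⟨ regroup (+ (a %ℕ n)) (a /ℕ n) q (+ n) ⟩
    + (a %ℕ n) ℤ.+ (a /ℕ n ℤ.+ q) ℤ.* + n       ∎)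
    where
    open ≡-Reasoning
    regroup : ∀ x p q m → x ℤ.+ p ℤ.* m ℤ.+ q ℤ.* m ≡ x ℤ.+ (p ℤ.+ q) ℤ.* m
    regroup = solve-∀

  toℕ-vtx : ∀ a → toℕ (vtx n a) ≡ a %ℕ n
  toℕ-vtx a = toℕ-fromℕ< (n%ℕd<d a n)

  vtx-periodic : ∀ a q → vtx n (a ℤ.+ q ℤ.* + n) ≡ vtx n a
  vtx-periodic a q =
    toℕ-injective (trans (toℕ-vtx (a ℤ.+ q ℤ.* + n)) (trans ([a+qn]%ℕn≡a%ℕn a q) (sym (toℕ-vtx a))))

  vtx-toℕ : ∀ v → vtx n (+ toℕ v) ≡ v
  vtx-toℕ v = toℕ-injective (trans (toℕ-vtx (+ toℕ v)) (m<n⇒m%n≡m (toℕ<n v)))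

  private
    vtx-reduce : ∀ a c → vtx n (+ toℕ (vtx n a) ℤ.+ c) ≡ vtx n (a ℤ.+ c)
    vtx-reduce a c = begin
      vtx n (+ toℕ (vtx n a) ℤ.+ c)               ≡⟨ cong (λ r → vtx n (+ r ℤ.+ c)) (toℕ-vtx a) ⟩
      vtx n (+ (a %ℕ n) ℤ.+ c)                    ≡⟨ vtx-periodic (+ (a %ℕ n) ℤ.+ c) (a /ℕ n) ⟨
      vtx n (+ (a %ℕ n) ℤ.+ c ℤ.+ a /ℕ n ℤ.* + n)
        ≡⟨ cong (vtx n) (regroup (+ (a %ℕ n)) c (a /ℕ n ℤ.* + n)) ⟩
      vtx n (+ (a %ℕ n) ℤ.+ a /ℕ n ℤ.* + n ℤ.+ c)
        ≡⟨ cong (λ x → vtx n (x ℤ.+ c)) (a≡a%ℕn+[a/ℕn]*n a n) ⟨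
      vtx n (a ℤ.+ c)                             ∎
      where
      open ≡-Reasoning
      regroup : ∀ x c y → x ℤ.+ c ℤ.+ y ≡ x ℤ.+ y ℤ.+ c
      regroup = solve-∀

  vtx-+ : ∀ a b c → vtx n a ≡ vtx n b → vtx n (a ℤ.+ c) ≡ vtx n (b ℤ.+ c)
  vtx-+ a b c eq = trans (sym (vtx-reduce a c)) (trans (cong (λ v → vtx n (+ toℕ v ℤ.+ c)) eq) (vtx-reduce b c))

  vtx-shift : ∀ a b c {a′ b′} → a ℤ.+ c ≡ a′ → b ℤ.+ c ≡ b′ →
    vtx n a ≡ vtx n b → vtx n a′ ≡ vtx n b′
  vtx-shift a b c refl refl = vtx-+ a b c

  head-e : ∀ a → head (e n a) ≡ vtx n (a ℤ.+ + 1)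
  head-e a = vtx-+ (+ toℕ (vtx n a)) a (+ 1) (vtx-toℕ (vtx n a))

  head-f : ∀ a → head (f n a) ≡ vtx n (a ℤ.+ + 2)
  head-f a = vtx-+ (+ toℕ (vtx n a)) a (+ 2) (vtx-toℕ (vtx n a))

module _ {n : ℕ} .{{_ : NonZero n}} where

  ∈-resp : ∀ (G : Sub n) {x y} → x ≡ y → G x ≡ true → G y ≡ true
  ∈-resp G = subst (λ x → G x ≡ true)

  UReach-mono : ∀ {G H : Sub n} → G ⊆E H → ∀ {u v} → UReach G u v → UReach H u v
  UReach-mono G⊆H here            = here
  UReach-mono G⊆H (fwd x Gx tx r) = fwd x (G⊆H x Gx) tx (UReach-mono G⊆H r)
  UReach-mono G⊆H (bwd x Gx hx r) = bwd x (G⊆H x Gx) hx (UReach-mono G⊆H r)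

  Reach-invariant : ∀ {G : Sub n} (X : Fin n → Set) →
    (∀ x → G x ≡ true → X (tail x) → X (head x)) → ∀ {u v} → X u → Reach G u v → X v
  Reach-invariant X step-X Xu here               = Xu
  Reach-invariant X step-X Xu (step x Gx refl r) = Reach-invariant X step-X (step-X x Gx Xu) r

  no-edge-into-root : ∀ {G : Sub n} {r} → ¬ HasClosedPath G → (∀ v → v ≢ r → Reach G r v) →
    ∀ {x} → G x ≡ true → head x ≢ r
  no-edge-into-root {G} {r} acyclic reach {x} Gx hx =
    acyclic (x , Gx , subst (λ w → Reach G w (tail x)) (sym hx) (reach-all (tail x)))
    where
    reach-all : ∀ v → Reach G r v
    reach-all v with v Fin.≟ r
    ... | yes refl = here
    ... | no v≢r   = reach v v≢r

  Closed₃ : Bool → Bool → Bool → Set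
  Closed₃ x y z = b2n {n} x ℕ.+ b2n {n} y ℕ.+ b2n {n} z ≤ 1 ⊎ (x ≡ true × y ≡ true × z ≡ true)

  Closed₃-resp : ∀ {x y z x′ y′ z′} → x ≡ x′ → y ≡ y′ → z ≡ z′ → Closed₃ x y z → Closed₃ x′ y′ z′
  Closed₃-resp refl refl refl c = c

  Closed₃-¬x¬y : ∀ {x y z} → x ≡ false → y ≡ false → Closed₃ x y z
  Closed₃-¬x¬y {z = false} refl refl = inj₁ z≤n
  Closed₃-¬x¬y {z = true}  refl refl = inj₁ (s≤s z≤n)

  Closed₃-¬x¬z : ∀ {x y z} → x ≡ false → z ≡ false → Closed₃ x y z
  Closed₃-¬x¬z {y = false} refl refl = inj₁ z≤n
  Closed₃-¬x¬z {y = true}  refl refl = inj₁ (s≤s z≤n)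

  Closed₃-¬y¬z : ∀ {x y z} → y ≡ false → z ≡ false → Closed₃ x y z
  Closed₃-¬y¬z {x = false} refl refl = inj₁ z≤n
  Closed₃-¬y¬z {x = true}  refl refl = inj₁ (s≤s z≤n)

  Closed₃-z⇒x≡y : ∀ {x y z} → Closed₃ x y z → z ≡ true → x ≡ y
  Closed₃-z⇒x≡y {false} {false} _                   _    = refl
  Closed₃-z⇒x≡y {true}  {true}  _                   _    = refl
  Closed₃-z⇒x≡y {true}  {false} (inj₁ (s≤s ()))     refl
  Closed₃-z⇒x≡y {false} {true}  (inj₁ (s≤s ()))     refl
  Closed₃-z⇒x≡y {true}  {false} (inj₂ (_ , () , _)) _
  Closed₃-z⇒x≡y {false} {true}  (inj₂ (() , _))     _

  Closed₃-x⇒y≡z : ∀ {x y z} → Closed₃ x y z → x ≡ true → y ≡ z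
  Closed₃-x⇒y≡z {y = false} {false} _                   _    = refl
  Closed₃-x⇒y≡z {y = true}  {true}  _                   _    = refl
  Closed₃-x⇒y≡z {y = true}  {false} (inj₁ (s≤s ()))     refl
  Closed₃-x⇒y≡z {y = false} {true}  (inj₁ (s≤s ()))     refl
  Closed₃-x⇒y≡z {y = true}  {false} (inj₂ (_ , _ , ())) _
  Closed₃-x⇒y≡z {y = false} {true}  (inj₂ (_ , () , _)) _

  Closed₃-y⇒x≡z : ∀ {x y z} → Closed₃ x y z → y ≡ true → x ≡ z
  Closed₃-y⇒x≡z {false} {z = false} _                   _    = refl
  Closed₃-y⇒x≡z {true}  {z = true}  _                   _    = refl
  Closed₃-y⇒x≡z {true}  {z = false} (inj₁ (s≤s ()))     refl
  Closed₃-y⇒x≡z {false} {z = true}  (inj₁ (s≤s ()))     refl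
  Closed₃-y⇒x≡z {true}  {z = false} (inj₂ (_ , _ , ())) _
  Closed₃-y⇒x≡z {false} {z = true}  (inj₂ (() , _))     _

module Positions (n : ℕ) .{{_ : NonZero n}} (j : ℤ) where
  open Residues n

  private
    -+-cancel : ∀ x y → x ℤ.- y ℤ.+ y ≡ x
    -+-cancel = solve-∀

    +--cancel : ∀ x y → x ℤ.+ y ℤ.- y ≡ x
    +--cancel = solve-∀

  root : Fin n
  root = vtx n j

  ver : ℕ → Fin n
  ver h = vtx n (j ℤ.+ + h)

  pos : Fin n → ℕ
  pos v = toℕ (vtx n (+ toℕ v ℤ.- j))

  fr : ℕ → Edge n
  fr h = e n (j ℤ.+ + h ℤ.- + 1)

  wi : ℕ → Edge n
  wi h = f n (j ℤ.+ + h ℤ.- + 2)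

  pos<n : ∀ v → pos v < n
  pos<n v = toℕ<n _

  ver-pos : ∀ v → ver (pos v) ≡ v
  ver-pos v = trans (vtx-shift (+ pos v) (+ toℕ v ℤ.- j) j (ℤP.+-comm (+ pos v) j) (-+-cancel (+ toℕ v) j)
                                (vtx-toℕ _))
                    (vtx-toℕ v)

  pos-ver : ∀ h → pos (ver h) ≡ h % n
  pos-ver h = trans (cong toℕ (vtx-shift (+ toℕ (ver h)) (j ℤ.+ + h) (ℤ.- j) refl (cancel j (+ h)) (vtx-toℕ (ver h))))
                    (toℕ-vtx (+ h))
    where
    cancel : ∀ x y → x ℤ.+ y ℤ.- x ≡ y
    cancel = solve-∀

  pos-ver< : ∀ {h} → h < n → pos (ver h) ≡ h
  pos-ver< {h} h<n = trans (pos-ver h) (m<n⇒m%n≡m h<n)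

  ver-injective : ∀ {h m} → 0 < h → h < n → m ≤ n → ver h ≡ ver m → h ≡ m
  ver-injective {h} {m} 0<h h<n m≤n eq with m≤n⇒m<n∨m≡n m≤n
  ... | inj₁ m<n  = trans (sym (pos-ver< h<n)) (trans (cong pos eq) (pos-ver< m<n))
  ... | inj₂ refl =
    contradiction (trans (sym (pos-ver< h<n)) (trans (cong pos eq) (trans (pos-ver n) (n%n≡0 n)))) (>⇒≢ 0<h)

  ver-0 : ver 0 ≡ root
  ver-0 = cong (vtx n) (ℤP.+-identityʳ j)

  ver-n : ver n ≡ ver 0
  ver-n = trans (cong (vtx n) (wrap j (+ n))) (vtx-periodic (j ℤ.+ + 0) (+ 1))
    where
    wrap : ∀ x m → x ℤ.+ m ≡ x ℤ.+ + 0 ℤ.+ + 1 ℤ.* m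
    wrap = solve-∀

  ver≢root : ∀ {h} → 0 < h → h < n → ver h ≢ root
  ver≢root 0<h h<n eq = >⇒≢ 0<h (ver-injective 0<h h<n z≤n (trans eq (sym ver-0)))

  pos-head>0 : ∀ {x} → head x ≢ root → 0 < pos (head x)
  pos-head>0 {x} hx≢root = n≢0⇒n>0 λ h≡0 → hx≢root (trans (sym (ver-pos (head x))) (trans (cong ver h≡0) ver-0))

  fr-cong : ∀ {a b} → ver a ≡ ver b → fr a ≡ fr b
  fr-cong {a} {b} = cong (frame ,_) ∘ vtx-+ (j ℤ.+ + a) (j ℤ.+ + b) (ℤ.- + 1)

  wi-cong : ∀ {a b} → ver a ≡ ver b → wi a ≡ wi b
  wi-cong {a} {b} = cong (window ,_) ∘ vtx-+ (j ℤ.+ + a) (j ℤ.+ + b) (ℤ.- + 2)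

  fr-n : fr n ≡ fr 0
  fr-n = fr-cong ver-n

  wi-n : wi n ≡ wi 0
  wi-n = wi-cong ver-n

  head-fr : ∀ h → head (fr h) ≡ ver h
  head-fr h = trans (head-e (j ℤ.+ + h ℤ.- + 1)) (cong (vtx n) (-+-cancel (j ℤ.+ + h) (+ 1)))

  head-wi : ∀ h → head (wi h) ≡ ver h
  head-wi h = trans (head-f (j ℤ.+ + h ℤ.- + 2)) (cong (vtx n) (-+-cancel (j ℤ.+ + h) (+ 2)))

  fr-from : ∀ h → fr (suc h) ≡ (frame , ver h)
  fr-from h = cong (e n) (shift j (+ h))
    where
    shift : ∀ x y → x ℤ.+ (+ 1 ℤ.+ y) ℤ.- + 1 ≡ x ℤ.+ y
    shift = solve-∀

  wi-from : ∀ h → wi (2 ℕ.+ h) ≡ (window , ver h)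
  wi-from h = cong (f n) (shift j (+ h))
    where
    shift : ∀ x y → x ℤ.+ (+ 2 ℤ.+ y) ℤ.- + 2 ≡ x ℤ.+ y
    shift = solve-∀

  edge-out-of : ∀ {x h} → tail x ≡ ver h → x ≡ fr (suc h) ⊎ x ≡ wi (2 ℕ.+ h)
  edge-out-of {frame  , v} {h} v≡ = inj₁ (sym (trans (fr-from h) (cong (frame ,_) (sym v≡))))
  edge-out-of {window , v} {h} v≡ = inj₂ (sym (trans (wi-from h) (cong (window ,_) (sym v≡))))

  edge-into : ∀ {x h} → head x ≡ ver h → x ≡ fr h ⊎ x ≡ wi h
  edge-into {x} hx with edge-out-of {x} (sym (ver-pos (tail x)))
  ... | inj₁ x≡fr = inj₁ (trans x≡fr (fr-cong (trans (sym (head-fr _)) (trans (cong head (sym x≡fr)) hx))))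
  ... | inj₂ x≡wi = inj₂ (trans x≡wi (wi-cong (trans (sym (head-wi _)) (trans (cong head (sym x≡wi)) hx))))

  edge-view : ∀ x → x ≡ fr (pos (head x)) ⊎ x ≡ wi (pos (head x))
  edge-view x = edge-into (sym (ver-pos (head x)))

  ≐-from-positions : ∀ {G H : Sub n} → (∀ h → h < n → G (fr h) ≡ H (fr h)) →
    (∀ h → h < n → G (wi h) ≡ H (wi h)) → G ≐ H
  ≐-from-positions {G} {H} on-fr on-wi x with edge-view x
  ... | inj₁ x≡fr = subst (λ y → G y ≡ H y) (sym x≡fr) (on-fr _ (pos<n (head x)))
  ... | inj₂ x≡wi = subst (λ y → G y ≡ H y) (sym x≡wi) (on-wi _ (pos<n (head x)))

  ClosedAt : Sub n → ℕ → Set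
  ClosedAt G h = Closed₃ (G (fr h)) (G (fr (suc h))) (G (wi (suc h)))

  Closed⇒ClosedAt : ∀ {G} → Closed G → ∀ h → ClosedAt G h
  Closed⇒ClosedAt {G} closed h =
    Closed₃-resp refl (cong (G ∘ e n) (next j (+ h))) (cong (G ∘ f n) (same j (+ h))) (closed (j ℤ.+ + h ℤ.- + 1))
    where
    next : ∀ x y → x ℤ.+ y ℤ.- + 1 ℤ.+ + 1 ≡ x ℤ.+ (+ 1 ℤ.+ y) ℤ.- + 1
    next = solve-∀
    same : ∀ x y → x ℤ.+ y ℤ.- + 1 ≡ x ℤ.+ (+ 1 ℤ.+ y) ℤ.- + 2
    same = solve-∀

  ClosedAt⇒Closed : ∀ {G} → (∀ h → h < n → ClosedAt G h) → Closed G
  ClosedAt⇒Closed {G} closed i = Closed₃-resp (cong G fr≡) (cong G fr-suc≡) (cong G wi-suc≡) (closed h (pos<n _))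
    where
    h = pos (vtx n (i ℤ.+ + 1))
    ver-h : ver h ≡ vtx n (i ℤ.+ + 1)
    ver-h = ver-pos _
    shift : ∀ x y → x ℤ.+ y ℤ.- + 1 ≡ x ℤ.+ (+ 1 ℤ.+ y) ℤ.- + 2
    shift = solve-∀
    fr≡ : fr h ≡ e n i
    fr≡ = cong (frame ,_) (vtx-shift (j ℤ.+ + h) (i ℤ.+ + 1) (ℤ.- + 1) refl (+--cancel i (+ 1)) ver-h)
    fr-suc≡ : fr (suc h) ≡ e n (i ℤ.+ + 1)
    fr-suc≡ = trans (fr-from h) (cong (frame ,_) ver-h)
    wi-suc≡ : wi (suc h) ≡ f n i
    wi-suc≡ = cong (window ,_) (vtx-shift (j ℤ.+ + h) (i ℤ.+ + 1) (ℤ.- + 1) (shift j (+ h)) (+--cancel i (+ 1)) ver-h)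

  pred[n]<n : pred n < n
  pred[n]<n = ≤-reflexive (suc-pred n)

  closedAt-wrap : ∀ {G} → ClosedAt G (pred n) → G (fr (pred n)) ≡ true → G (fr 0) ≡ G (wi 0)
  closedAt-wrap {G} closed last = begin
    G (fr 0)              ≡⟨ cong G fr-n ⟨
    G (fr n)              ≡⟨ cong (G ∘ fr) (suc-pred n) ⟨
    G (fr (suc (pred n))) ≡⟨ Closed₃-x⇒y≡z closed last ⟩
    G (wi (suc (pred n))) ≡⟨ cong (G ∘ wi) (suc-pred n) ⟩
    G (wi n)              ≡⟨ cong G wi-n ⟩
    G (wi 0)              ∎
    where open ≡-Reasoning

  frames⇒full : ∀ {G} → (∀ h → ClosedAt G h) → (∀ h → h < n → G (fr h) ≡ true) → G ≐ full n
  frames⇒full {G} closed frames = ≐-from-positions frames all-windows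
    where
    all-windows : ∀ h → h < n → G (wi h) ≡ true
    all-windows zero    0<n   = trans (sym (closedAt-wrap {G} (closed (pred n)) (frames (pred n) pred[n]<n))) (frames 0 0<n)
    all-windows (suc h) 1+h<n =
      trans (sym (Closed₃-x⇒y≡z (closed h) (frames h (<-trans (n<1+n h) 1+h<n)))) (frames (suc h) 1+h<n)

  private
    ⌊⌋≡true : ∀ {A : Set} (a? : Dec A) → A → ⌊ a? ⌋ ≡ true
    ⌊⌋≡true a? a = trans (isYes≗does a?) (dec-true a? a)

    ⌊⌋≡false : ∀ {A : Set} (a? : Dec A) → ¬ A → ⌊ a? ⌋ ≡ false
    ⌊⌋≡false a? ¬a = trans (isYes≗does a?) (dec-false a? ¬a)

    not-∨-left : ∀ {a b} → a ≡ true → not (a ∨ b) ≡ false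
    not-∨-left refl = refl

    not-∨-right : ∀ {a b} → b ≡ true → not (a ∨ b) ≡ false
    not-∨-right {a} refl = cong not (∨-zeroʳ a)

  module _ (k : ℕ) where

    S-fr-false : ∀ {h} → h ≤ 2 ℕ.* k → S k j (fr h) ≡ false
    S-fr-false {h} h≤2k = cong not (Equivalence.to T-≡ (any⁺ _ (lose (∈-upTo⁺ (s≤s h≤2k)) (fromWitness hit))))
      where
      reorder : ∀ x y → x ℤ.+ y ℤ.- + 1 ≡ x ℤ.- + 1 ℤ.+ y
      reorder = solve-∀
      hit : vtx n (j ℤ.+ + h ℤ.- + 1) ≡ vtx n (j ℤ.- + 1 ℤ.+ + h)
      hit = cong (vtx n) (reorder j (+ h))

    S-fr-true : ∀ {h} → 2 ℕ.* k < h → h < n → S k j (fr h) ≡ true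
    S-fr-true {h} 2k<h h<n = cong not (¬-not no-hit)
      where
      shift : ∀ x y → x ℤ.- + 1 ℤ.+ y ℤ.+ + 1 ≡ x ℤ.+ y
      shift = solve-∀
      no-hit : any (λ t → ⌊ vtx n (j ℤ.+ + h ℤ.- + 1) Fin.≟ vtx n (j ℤ.- + 1 ℤ.+ + t) ⌋) (upTo (suc (2 ℕ.* k)))
               ≢ true
      no-hit hit with find (any⁻ _ _ (Equivalence.from T-≡ hit))
      ... | t , t∈ , hit-t = <⇒≱ 2k<h (subst (_≤ 2 ℕ.* k) (sym h≡t) t≤2k)
        where
        t≤2k : t ≤ 2 ℕ.* k
        t≤2k = s≤s⁻¹ (∈-upTo⁻ t∈)
        h≡t : h ≡ t
        h≡t = ver-injective (≤-<-trans z≤n 2k<h) h<n (<⇒≤ (≤-<-trans t≤2k (<-trans 2k<h h<n)))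
                (vtx-shift (j ℤ.+ + h ℤ.- + 1) (j ℤ.- + 1 ℤ.+ + t) (+ 1) (-+-cancel (j ℤ.+ + h) (+ 1)) (shift j (+ t))
                  (toWitness hit-t))

    S-wi-0 : S k j (wi 0) ≡ false
    S-wi-0 = not-∨-left (⌊⌋≡true (_ Fin.≟ _) (cong (vtx n) (drop-0 j)))
      where
      drop-0 : ∀ x → x ℤ.+ + 0 ℤ.- + 2 ≡ x ℤ.- + 2
      drop-0 = solve-∀

    S-wi-odd : S k j (wi (suc (2 ℕ.* k))) ≡ false
    S-wi-odd = not-∨-right (⌊⌋≡true (_ Fin.≟ _) (cong (vtx n) (shift j (+ (2 ℕ.* k)))))
      where
      shift : ∀ x y → x ℤ.+ (+ 1 ℤ.+ y) ℤ.- + 2 ≡ x ℤ.+ y ℤ.- + 1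
      shift = solve-∀

    S-wi-true : ∀ {h} → 2 ℕ.* k < n → 0 < h → h < n → h ≢ suc (2 ℕ.* k) → S k j (wi h) ≡ true
    S-wi-true {h} 2k<n 0<h h<n h≢odd =
      cong₂ (λ a b → not (a ∨ b)) (⌊⌋≡false (_ Fin.≟ _) not-first) (⌊⌋≡false (_ Fin.≟ _) not-second)
      where
      up-0 : ∀ x → x ℤ.- + 2 ℤ.+ + 2 ≡ x ℤ.+ + 0
      up-0 = solve-∀
      up-odd : ∀ x y → x ℤ.+ y ℤ.- + 1 ℤ.+ + 2 ≡ x ℤ.+ (+ 1 ℤ.+ y)
      up-odd = solve-∀
      not-first : vtx n (j ℤ.+ + h ℤ.- + 2) ≢ vtx n (j ℤ.- + 2)
      not-first eq = >⇒≢ 0<h (ver-injective 0<h h<n z≤n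
        (vtx-shift (j ℤ.+ + h ℤ.- + 2) (j ℤ.- + 2) (+ 2) (-+-cancel (j ℤ.+ + h) (+ 2)) (up-0 j) eq))
      not-second : vtx n (j ℤ.+ + h ℤ.- + 2) ≢ vtx n (j ℤ.+ + (2 ℕ.* k) ℤ.- + 1)
      not-second eq = h≢odd (ver-injective 0<h h<n 2k<n
        (vtx-shift (j ℤ.+ + h ℤ.- + 2) (j ℤ.+ + (2 ℕ.* k) ℤ.- + 1) (+ 2) (-+-cancel (j ℤ.+ + h) (+ 2))
                   (up-odd j (+ (2 ℕ.* k))) eq))

    S-closedAt : 2 ℕ.* k < n → ∀ h → h < n → ClosedAt (S k j) h
    S-closedAt 2k<n h h<n with <-cmp h (2 ℕ.* k)
    ... | tri< h<2k _ _ = Closed₃-¬x¬y (S-fr-false (<⇒≤ h<2k)) (S-fr-false h<2k)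
    ... | tri≈ _ refl _ = Closed₃-¬x¬z (S-fr-false ≤-refl) S-wi-odd
    ... | tri> _ _ 2k<h with m≤n⇒m<n∨m≡n h<n
    ...   | inj₁ 1+h<n = inj₂ (S-fr-true 2k<h h<n , S-fr-true (<-trans 2k<h (n<1+n h)) 1+h<n ,
                               S-wi-true 2k<n z<s 1+h<n (>⇒≢ (s≤s 2k<h)))
    ...   | inj₂ refl    =
      Closed₃-¬y¬z (trans (cong (S k j) fr-n) (S-fr-false z≤n)) (trans (cong (S k j) wi-n) S-wi-0)

    S-nontrivial : Nontrivial (S k j)
    S-nontrivial (inj₁ S≐full)          = contradiction (trans (sym (S-fr-false z≤n)) (S≐full (fr 0))) λ ()
    S-nontrivial (inj₂ (_ , S≐windows)) = contradiction (trans (sym S-wi-0) (S≐windows (wi 0))) λ ()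

  in-edge : ∀ {G h} → InDegOne G (ver h) → G (fr h) ≡ true ⊎ G (wi h) ≡ true
  in-edge {G} (x , (Gx , hx) , _) =
    Sum.map (λ x≡fr → ∈-resp G x≡fr Gx) (λ x≡wi → ∈-resp G x≡wi Gx) (edge-into hx)

  in-edge-unique : ∀ {G h} → InDegOne G (ver h) → G (fr h) ≡ true → G (wi h) ≡ true → ⊥
  in-edge-unique {h = h} (_ , _ , unique) Gfr Gwi
    with () ← trans (unique (fr h) Gfr (head-fr h)) (sym (unique (wi h) Gwi (head-wi h)))

  record FirstFrame (G : Sub n) (p : ℕ) : Set where
    field
      positive     : 0 < p
      bounded      : p ≤ n
      absent-below : ∀ h → 0 < h → h < p → G (fr h) ≡ false
      present      : p < n → G (fr p) ≡ true

  open FirstFrame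

  first-frame : ∀ G → Σ ℕ (FirstFrame G)
  first-frame G with least-below (λ h → G (fr (suc h))) (pred n)
  ... | p , p≤ , below , first = suc p , record
    { positive     = z<s
    ; bounded      = m≤pred[n]⇒suc[m]≤n p≤
    ; absent-below = λ { (suc h) _ (s≤s h<p) → below h h<p }
    ; present      = first ∘ <⇒≤pred
    }

  EvenBelow : ℕ → Fin n → Set
  EvenBelow q v = Σ ℕ λ q′ → q′ < q × v ≡ ver (2 ℕ.* q′)

  module _ {G : Sub n} {q : ℕ} (indeg : ∀ v → v ≢ root → InDegOne G v) (ff : FirstFrame G (2 ℕ.* q)) where

    private
      window-target : ∀ {q′} → 2 ℕ.+ 2 ℕ.* q′ ≤ 2 ℕ.* q → G (wi (2 ℕ.+ 2 ℕ.* q′)) ≡ true →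
        EvenBelow q (ver (2 ℕ.+ 2 ℕ.* q′))
      window-target {q′} ≤2q Gwi with m≤n⇒m<n∨m≡n ≤2q
      ... | inj₁ <2q  = suc q′ , *-cancelˡ-< 2 _ _ (subst (_< 2 ℕ.* q) (sym (*-suc 2 q′)) <2q) ,
                        cong ver (sym (*-suc 2 q′))
      ... | inj₂ ≡2q with m≤n⇒m<n∨m≡n (bounded ff)
      ...   | inj₁ 2q<n = ⊥-elim (in-edge-unique (indeg (ver (2 ℕ.* q)) (ver≢root (positive ff) 2q<n))
                                  (present ff 2q<n) (∈-resp G (cong wi ≡2q) Gwi))
      ...   | inj₂ 2q≡n = 0 , *-cancelˡ-< 2 0 q (positive ff) , trans (cong ver (trans ≡2q 2q≡n)) ver-n

    EvenBelow-closed : ∀ x → G x ≡ true → EvenBelow q (tail x) → EvenBelow q (head x)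
    EvenBelow-closed x Gx (q′ , q′<q , tail≡) with edge-out-of {x} tail≡
    ... | inj₁ x≡fr =
      contradiction (trans (sym (absent-below ff _ z<s (k<k′⇒2+2k≤2k′ q′<q))) (∈-resp G x≡fr Gx)) λ ()
    ... | inj₂ x≡wi = subst (EvenBelow q) (sym (trans (cong head x≡wi) (head-wi _)))
                        (window-target {q′} (k<k′⇒2+2k≤2k′ q′<q) (∈-resp G x≡wi Gx))

  first-frame-odd : ∀ {G p} → 1 < n → (∀ v → v ≢ root → Reach G root v) →
    (∀ v → v ≢ root → InDegOne G v) → FirstFrame G p → Σ ℕ λ k → p ≡ suc (2 ℕ.* k)
  first-frame-odd {G} {p} 1<n reach indeg ff with even⊎odd p
  ... | inj₂ odd        = odd
  ... | inj₁ (q , refl) with Reach-invariant (EvenBelow q) (EvenBelow-closed indeg ff)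
                               (0 , *-cancelˡ-< 2 0 q (positive ff) , sym ver-0) (reach (ver 1) (ver≢root z<s 1<n))
  ...   | q′ , q′<q , ver1≡ = contradiction (m*n≡1⇒m≡1 2 q′ (sym 1≡2q′)) λ ()
    where
    1≡2q′ : 1 ≡ 2 ℕ.* q′
    1≡2q′ = ver-injective z<s 1<n (≤-trans (<⇒≤ (*-monoʳ-< 2 q′<q)) (bounded ff)) ver1≡

  record Skeleton (k : ℕ) (G : Sub n) : Set where
    field
      windows-low  : ∀ h → 0 < h → h ≤ 2 ℕ.* k → G (wi h) ≡ true
      frame-odd    : suc (2 ℕ.* k) < n → G (fr (suc (2 ℕ.* k))) ≡ true
      in-edge-high : ∀ h → suc (2 ℕ.* k) < h → h < n → G (fr h) ≡ true ⊎ G (wi h) ≡ true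

  open Skeleton

  Skeleton-mono : ∀ {k G H} → G ⊆E H → Skeleton k G → Skeleton k H
  Skeleton-mono G⊆H skel = record
    { windows-low  = λ h 0<h h≤2k → G⊆H _ (windows-low skel h 0<h h≤2k)
    ; frame-odd    = G⊆H _ ∘ frame-odd skel
    ; in-edge-high = λ h odd<h h<n → Sum.map (G⊆H _) (G⊆H _) (in-edge-high skel h odd<h h<n)
    }

  module _ {G : Sub n} {k : ℕ} (indeg : ∀ v → v ≢ root → InDegOne G v) (ff : FirstFrame G (suc (2 ℕ.* k))) where

    first-frame-skeleton : Skeleton k G
    first-frame-skeleton = record
      { windows-low  = windows-low′
      ; frame-odd    = present ff
      ; in-edge-high = λ h odd<h h<n → in-edge (indeg (ver h) (ver≢root (<-trans z<s odd<h) h<n))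
      }
      where
      windows-low′ : ∀ h → 0 < h → h ≤ 2 ℕ.* k → G (wi h) ≡ true
      windows-low′ h 0<h h≤2k with in-edge (indeg (ver h) (ver≢root 0<h (≤-<-trans h≤2k (bounded ff))))
      ... | inj₁ Gfr = contradiction (trans (sym (absent-below ff h 0<h (s≤s h≤2k))) Gfr) λ ()
      ... | inj₂ Gwi = Gwi

    first-frame-⊆S : (∀ {x} → G x ≡ true → head x ≢ root) → G ⊆E S k j
    first-frame-⊆S into-root x Gx with edge-view x
    ... | inj₁ x≡fr = ∈-resp (S k j) (sym x≡fr) (S-fr-true k 2k<h (pos<n _))
      where
      2k<h : 2 ℕ.* k < pos (head x)
      2k<h with ≤-<-connex (pos (head x)) (2 ℕ.* k)
      ... | inj₂ 2k<h = 2k<h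
      ... | inj₁ h≤2k = contradiction (trans (sym (absent-below ff _ (pos-head>0 {x} (into-root Gx)) (s≤s h≤2k)))
                                             (∈-resp G x≡fr Gx)) λ ()
    ... | inj₂ x≡wi =
      ∈-resp (S k j) (sym x≡wi) (S-wi-true k (bounded ff) (pos-head>0 {x} (into-root Gx)) (pos<n _) h≢odd)
      where
      h≢odd : pos (head x) ≢ suc (2 ℕ.* k)
      h≢odd h≡odd = in-edge-unique (indeg (ver (suc (2 ℕ.* k))) (ver≢root z<s odd<n)) (present ff odd<n)
                      (∈-resp G (trans x≡wi (cong wi h≡odd)) Gx)
        where
        odd<n : suc (2 ℕ.* k) < n
        odd<n = subst (_< n) h≡odd (pos<n _)

  tree-skeleton : ∀ {Tr} → 1 < n → IsDirSpanningTree (full n) root Tr →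
    Σ ℕ λ k → 2 ℕ.* k < n × Skeleton k Tr × Tr ⊆E S k j
  tree-skeleton {Tr} 1<n (_ , _ , acyclic , indeg , reach) with first-frame Tr
  ... | p , ff with first-frame-odd 1<n reach indeg ff
  ...   | k , refl = k , bounded ff , first-frame-skeleton indeg ff ,
                     first-frame-⊆S indeg ff (no-edge-into-root acyclic reach)

  module _ {H : Sub n} {k : ℕ} (2k<n : 2 ℕ.* k < n) (closed : ∀ h → ClosedAt H h) (skel : Skeleton k H) where

    frames-high : ∀ h → 2 ℕ.* k < h → h < n → H (fr h) ≡ true
    frames-high (suc h) 2k<1+h 1+h<n with m≤n⇒m<n∨m≡n 2k<1+h
    ... | inj₂ refl    = frame-odd skel 1+h<n
    ... | inj₁ odd<1+h with in-edge-high skel (suc h) odd<1+h 1+h<n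
    ...   | inj₁ Hfr = Hfr
    ...   | inj₂ Hwi = trans (Closed₃-x⇒y≡z (closed h) (frames-high h (s≤s⁻¹ odd<1+h) (<-trans (n<1+n h) 1+h<n))) Hwi

    windows-high : ∀ h → suc (2 ℕ.* k) < h → h < n → H (wi h) ≡ true
    windows-high (suc h) odd<1+h 1+h<n =
      trans (sym (Closed₃-x⇒y≡z (closed h) (frames-high h (s≤s⁻¹ odd<1+h) (<-trans (n<1+n h) 1+h<n))))
            (frames-high (suc h) (<⇒≤ odd<1+h) 1+h<n)

    frames-low : ∀ h → h ≤ 2 ℕ.* k → H (fr h) ≡ H (fr 0)
    frames-low zero    _      = refl
    frames-low (suc h) 1+h≤2k =
      trans (sym (Closed₃-z⇒x≡y (closed h) (windows-low skel (suc h) z<s 1+h≤2k))) (frames-low h (<⇒≤ 1+h≤2k))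

    module _ (nontrivial : Nontrivial H) where

      fr0-absent : H (fr 0) ≡ false
      fr0-absent = ¬-not λ Hfr0 → nontrivial (inj₁ (frames⇒full closed (all-frames Hfr0)))
        where
        all-frames : H (fr 0) ≡ true → ∀ h → h < n → H (fr h) ≡ true
        all-frames Hfr0 h h<n with ≤-<-connex h (2 ℕ.* k)
        ... | inj₁ h≤2k = trans (frames-low h h≤2k) Hfr0
        ... | inj₂ 2k<h = frames-high h 2k<h h<n

      frames-low-absent : ∀ h → h ≤ 2 ℕ.* k → H (fr h) ≡ false
      frames-low-absent h h≤2k = trans (frames-low h h≤2k) fr0-absent

      wi0-absent : H (wi 0) ≡ false
      wi0-absent with m≤n⇒m<n∨m≡n 2k<n
      ... | inj₁ odd<n =
        trans (sym (closedAt-wrap {H} (closed (pred n)) (frames-high (pred n) (<⇒≤pred odd<n) pred[n]<n))) fr0-absent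
      ... | inj₂ odd≡n = ¬-not λ Hwi0 → nontrivial (inj₂ (n-odd , only-windows Hwi0))
        where
        n-odd : n % 2 ≡ 1
        n-odd = trans (cong (_% 2) (sym odd≡n)) (trans (cong (λ m → suc m % 2) (*-comm 2 k)) ([m+kn]%n≡m%n 1 k 2))
        below-odd : ∀ {h} → h < n → h ≤ 2 ℕ.* k
        below-odd h<n = s≤s⁻¹ (subst (_ <_) (sym odd≡n) h<n)
        only-windows : H (wi 0) ≡ true → H ≐ windows
        only-windows Hwi0 = ≐-from-positions (λ h h<n → frames-low-absent h (below-odd h<n))
          λ { zero _ → Hwi0 ; (suc h) 1+h<n → windows-low skel (suc h) z<s (below-odd 1+h<n) }

      wi-odd-absent : suc (2 ℕ.* k) < n → H (wi (suc (2 ℕ.* k))) ≡ false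
      wi-odd-absent odd<n =
        trans (sym (Closed₃-y⇒x≡z (closed (2 ℕ.* k)) (frame-odd skel odd<n))) (frames-low-absent _ ≤-refl)

      skeleton-determines : H ≐ S k j
      skeleton-determines = ≐-from-positions on-frames on-windows
        where
        on-frames : ∀ h → h < n → H (fr h) ≡ S k j (fr h)
        on-frames h h<n with ≤-<-connex h (2 ℕ.* k)
        ... | inj₁ h≤2k = trans (frames-low-absent h h≤2k) (sym (S-fr-false k h≤2k))
        ... | inj₂ 2k<h = trans (frames-high h 2k<h h<n) (sym (S-fr-true k 2k<h h<n))
        on-windows : ∀ h → h < n → H (wi h) ≡ S k j (wi h)
        on-windows zero    _     = trans wi0-absent (sym (S-wi-0 k))
        on-windows (suc h) 1+h<n with <-cmp (suc h) (suc (2 ℕ.* k))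
        ... | tri< 1+h<odd _ _ = trans (windows-low skel (suc h) z<s (s≤s⁻¹ 1+h<odd))
                                       (sym (S-wi-true k 2k<n z<s 1+h<n (<⇒≢ 1+h<odd)))
        ... | tri≈ _ refl _    = trans (wi-odd-absent 1+h<n) (sym (S-wi-odd k))
        ... | tri> _ _ odd<1+h = trans (windows-high (suc h) odd<1+h 1+h<n)
                                       (sym (S-wi-true k 2k<n z<s 1+h<n (>⇒≢ odd<1+h)))

  closed-cover : ∀ {Tr} → 1 < n → IsDirSpanningTree (full n) root Tr →
    Σ ℕ λ k → 2 ℕ.* k < n × GoodCover Tr (S k j) × (∀ H → GoodCover Tr H → H ≐ S k j)
  closed-cover 1<n tree@(_ , connected , _) with tree-skeleton 1<n tree
  ... | k , 2k<n , skel , Tr⊆S =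
    k , 2k<n ,
    (S-nontrivial k , (λ u v → UReach-mono Tr⊆S (connected u v)) ,
     ClosedAt⇒Closed {S k j} (S-closedAt k 2k<n) , Tr⊆S) ,
    λ { H (nontrivial , _ , closed , Tr⊆H) →
          skeleton-determines 2k<n (Closed⇒ClosedAt {H} closed) (Skeleton-mono Tr⊆H skel) nontrivial }

  tree-in-some-S : ∀ {Tr} → 1 < n → IsDirSpanningTree (full n) root Tr →
    Σ ℕ λ k → k ≤ ⌈ n ∸ 2 /2⌉ × IsDirSpanningTree (S k j) root Tr
  tree-in-some-S 1<n tree@(_ , rest) with tree-skeleton 1<n tree
  ... | k , 2k<n , _ , Tr⊆S = k , 2*k<n⇒k≤⌈n∸2/2⌉ 1<n 2k<n , Tr⊆S , rest

  S-trees-disjoint : ∀ {Tr k k′} → k < k′ → 2 ℕ.* k′ < n →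
    IsDirSpanningTree (S k j) root Tr → IsDirSpanningTree (S k′ j) root Tr → ⊥
  S-trees-disjoint {Tr} {k} {k′} k<k′ 2k′<n (Tr⊆S , _ , _ , indeg , _) (Tr⊆S′ , _)
    with in-edge (indeg (ver (suc (2 ℕ.* k))) (ver≢root z<s (<-trans (k<k′⇒2+2k≤2k′ k<k′) 2k′<n)))
  ... | inj₁ Trfr = contradiction (trans (sym (S-fr-false k′ (<⇒≤ (k<k′⇒2+2k≤2k′ k<k′)))) (Tr⊆S′ _ Trfr)) λ ()
  ... | inj₂ Trwi = contradiction (trans (sym (S-wi-odd k)) (Tr⊆S _ Trwi)) λ ()

  S-tree-level-unique : ∀ {Tr} → 1 < n → (k k′ : ℕ) → k ≤ ⌈ n ∸ 2 /2⌉ → k′ ≤ ⌈ n ∸ 2 /2⌉ →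
    IsDirSpanningTree (S k j) root Tr → IsDirSpanningTree (S k′ j) root Tr → k ≡ k′
  S-tree-level-unique 1<n k k′ k≤ k′≤ tree tree′ with <-cmp k k′
  ... | tri< k<k′ _ _ = ⊥-elim (S-trees-disjoint k<k′ (k≤⌈n∸2/2⌉⇒2*k<n 1<n k′≤) tree tree′)
  ... | tri≈ _ k≡k′ _ = k≡k′
  ... | tri> _ _ k′<k = ⊥-elim (S-trees-disjoint k′<k (k≤⌈n∸2/2⌉⇒2*k<n 1<n k≤) tree′ tree)

unique-closed-cover : (n : ℕ) .{{_ : NonZero n}} → 1 < n →
  (j : ℤ) (Tr : Sub n) → IsDirSpanningTree (full n) (vtx n j) Tr →
  Σ (Sub n) λ H → (GoodCover Tr H × (∀ H′ → GoodCover Tr H′ → H′ ≐ H)) ×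
    Σ ℕ λ k → Σ ℕ λ j′ → k ≤ ⌈ n ∸ 2 /2⌉ × j′ < n × H ≐ S k (+ j′)
unique-closed-cover n 1<n j Tr tree
  with Positions.closed-cover n (+ toℕ (vtx n j)) 1<n
         (subst (λ r → IsDirSpanningTree (full n) r Tr) (sym (Residues.vtx-toℕ n (vtx n j))) tree)
... | k , 2k<n , good , unique =
  S k (+ toℕ (vtx n j)) , (good , unique) ,
  k , toℕ (vtx n j) , 2*k<n⇒k≤⌈n∸2/2⌉ 1<n 2k<n , toℕ<n (vtx n j) , λ _ → refl

theorem4p1 : (n : ℕ) .{{_ : NonZero n}} → 5 ≤ n →
    ((j : ℤ) (Tr : Sub n) → IsDirSpanningTree (full n) (vtx n j) Tr →
      Σ (Sub n) λ H → (GoodCover Tr H × (∀ H′ → GoodCover Tr H′ → H′ ≐ H)) ×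
        Σ ℕ λ k → Σ ℕ λ j′ → k ≤ ⌈ n ∸ 2 /2⌉ × j′ < n × H ≐ S k (+ j′))
    × ((j : ℤ) (Tr : Sub n) →
      (IsDirSpanningTree (full n) (vtx n j) Tr →
        Σ ℕ λ k → k ≤ ⌈ n ∸ 2 /2⌉ × IsDirSpanningTree (S k j) (vtx n j) Tr)
      × ((k : ℕ) → k ≤ ⌈ n ∸ 2 /2⌉ → IsDirSpanningTree (S k j) (vtx n j) Tr →
        IsDirSpanningTree (full n) (vtx n j) Tr)
      × ((k k′ : ℕ) → k ≤ ⌈ n ∸ 2 /2⌉ → k′ ≤ ⌈ n ∸ 2 /2⌉ →
        IsDirSpanningTree (S k j) (vtx n j) Tr → IsDirSpanningTree (S k′ j) (vtx n j) Tr →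
        k ≡ k′))
theorem4p1 n n≥5 = unique-closed-cover n 1<n , λ j Tr →
  Positions.tree-in-some-S n j 1<n ,
  (λ _ _ (_ , tree) → (λ _ _ → refl) , tree) ,
  Positions.S-tree-level-unique n j 1<n
  where
  1<n : 1 < n
  1<n = ≤-trans (s≤s (s≤s z≤n)) n≥5
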